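{- Let $\Lambda$ be a numerical semigroup that is not ordinary, and let $\lambda_{i_1}<\lambda_{i_2}<\dots<\lambda_{i_k}$ be the minimal generators of $\Lambda$ that are larger than the Frobenius number of $\Lambda$. Then for each $j\in\{1,\dots,k\}$, the number of minimal generators of the numerical semigroup $\Lambda\setminus\{\lambda_{i_j}\}$ that are larger than the Frobenius number of $\Lambda\setminus\{\lambda_{i_j}\}$ is at least $k-j$ and at most $k-j+1$.
   Context: A numerical semigroup is a subset $\Lambda\subseteq\mathbb{N}_0$ containing $0$, closed under addition, with finite complement in $\mathbb{N}_0$. Its Frobenius number is the largest element of $\mathbb{N}_0\setminus\Lambda$ (the largest gap). A minimal generator of $\Lambda$ is a nonzero element of $\Lambda$ that is not the sum of two nonzero elements of $\Lambda$. A numerical semigroup is ordinary if it equals $\{0\}\cup\{i\in\mathbb{N}_0 : i\ge c\}$ for some non-negative integer $c$. -}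

module Defs where

open import Data.Nat using (ℕ; zero; suc; _+_; _≤_; _<_)
open import Data.Product using (Σ; ∃; ∃-syntax; _×_; _,_)
open import Data.Sum using (_⊎_)
open import Relation.Nullary using (¬_)
open import Relation.Binary.PropositionalEquality using (_≡_; _≢_)
open import Function.Bundles using (_⇔_)

Subset : Set₁
Subset = ℕ → Set

-- Numerical semigroup: contains 0, closed under +, finite complement
-- (equivalently: contains every integer from some point on).
record IsNumericalSemigroup (Λ : Subset) : Set where
  field
    zero∈   : Λ 0
    +-closed : ∀ {a b} → Λ a → Λ b → Λ (a + b)
    cofinite : ∃[ c ] (∀ n → c ≤ n → Λ n)

IsFrobenius : Subset → ℕ → Set
IsFrobenius Λ F = ¬ Λ F × (∀ n → F < n → Λ n)

IsOrdinary : Subset → Set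
IsOrdinary Λ = ∃[ c ] (∀ i → Λ i ⇔ (i ≡ 0 ⊎ c ≤ i))

IsMinGen : Subset → ℕ → Set
IsMinGen Λ x =
  0 < x × Λ x ×
  ¬ (∃[ a ] ∃[ b ] (0 < a × 0 < b × Λ a × Λ b × a + b ≡ x))

remove : Subset → ℕ → Subset
remove Λ g x = Λ x × x ≢ g

module Submission where

-- Write g for the removed generator and Λ' = Λ ∖ {g}. Every element above the Frobenius
-- number F is in Λ, so the Frobenius number of Λ' is g itself. The minimal generators of Λ
-- above g stay minimal generators of Λ', which gives the lower bound. A minimal generator x of
-- Λ' that is not one of Λ must be g + a with 0 < a ∈ Λ; since Λ is not ordinary it has an
-- element 0 < e < F, and if c ∈ Λ ∖ {0, g} were smaller than a, then x = (g + a − c) + c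
-- would decompose in Λ'. Taking c = e and then c = the other translate shows that there is at
-- most one such new generator, which gives the upper bound.

open import Defs
open import Data.Nat using (ℕ; suc; _+_; _∸_; _≤_; _<_; _≟_; z≤n; s≤s)
open import Data.Nat.Properties
open import Data.Product using (_×_; _,_; ∃-syntax; proj₁; proj₂)
import Data.Product as Product
open import Data.Sum using (_⊎_; inj₁; inj₂)
open import Data.Empty using (⊥-elim)
open import Data.Fin using (Fin; toℕ; zero; suc)
open import Data.Fin.Properties using (injective⇒≤)
open import Data.List using (List; _∷_; length; lookup; drop)
open import Data.List.Properties using (length-drop)
open import Data.List.Relation.Unary.Any using (here; there; any?)
open import Data.List.Relation.Unary.All as All using ()
open import Data.List.Relation.Unary.AllPairs as AllPairs using (AllPairs; _∷_)
open import Data.List.Relation.Unary.Linked using (Linked)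
open import Data.List.Relation.Unary.Linked.Properties using (Linked⇒AllPairs)
open import Data.List.Relation.Unary.Unique.Propositional using (Unique)
import Data.List.Relation.Unary.Unique.Propositional.Properties as Unique
open import Data.List.Relation.Binary.Subset.Propositional using (_⊆_)
open import Data.List.Membership.Propositional using (_∈_; _∉_; find; lose)
open import Data.List.Membership.Propositional.Properties using (∈-lookup)
open import Data.List.Membership.Setoid.Properties using (index-injective)
import Data.List.Membership.DecPropositional as DecMembership
open import Function using (_∘_)
open import Function.Bundles using (_⇔_; mk⇔; Equivalence)
open import Level using (Level)
open import Relation.Nullary using (¬_; yes; no; ¬?)
open import Relation.Nullary.Decidable using (decidable-stable)
open import Relation.Binary.Core using (Rel)
open import Relation.Binary.Definitions using (Asymmetric; DecidableEquality; tri<; tri≈; tri>)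
open import Relation.Binary.PropositionalEquality
  using (_≡_; _≢_; refl; sym; trans; cong; subst; setoid; module ≡-Reasoning)

open Equivalence using (to; from)

private
  variable
    a ℓ : Level
    A : Set a

Unique-lookup-injective : ∀ {xs : List A} → Unique xs → ∀ {i j} →
                          lookup xs i ≡ lookup xs j → i ≡ j
Unique-lookup-injective (_ ∷ _) {zero} {zero} _ = refl
Unique-lookup-injective (x∉xs ∷ _) {zero} {suc j} eq = ⊥-elim (All.lookup x∉xs (∈-lookup j) eq)
Unique-lookup-injective (x∉xs ∷ _) {suc i} {zero} eq = ⊥-elim (All.lookup x∉xs (∈-lookup i) (sym eq))
Unique-lookup-injective (_ ∷ unique) {suc i} {suc j} eq = cong suc (Unique-lookup-injective unique eq)

Unique∧⊆⇒length≤ : ∀ {xs ys : List A} → Unique xs → xs ⊆ ys → length xs ≤ length ys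
Unique∧⊆⇒length≤ {A = A} {xs} unique xs⊆ys = injective⇒≤ λ {i} {j} eq →
  Unique-lookup-injective unique
    (index-injective (setoid A) (xs⊆ys (∈-lookup i)) (xs⊆ys (∈-lookup j)) eq)

module _ (_≟ᴬ_ : DecidableEquality A) where

  open DecMembership _≟ᴬ_ using (_∈?_)

  Unique∧⊆-but-one⇒length≤ : ∀ {xs ys : List A} → Unique xs →
    (∀ {x y} → x ∈ xs → y ∈ xs → x ∉ ys → y ∉ ys → x ≡ y) →
    length xs ≤ suc (length ys)
  Unique∧⊆-but-one⇒length≤ {xs} {ys} unique outside-equal with any? (λ x → ¬? (x ∈? ys)) xs
  ... | no ¬outside = m≤n⇒m≤1+n (Unique∧⊆⇒length≤ unique λ {x} x∈xs →
          decidable-stable (x ∈? ys) (¬outside ∘ lose x∈xs))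
  ... | yes outside with (x₀ , x₀∈xs , x₀∉ys) ← find outside =
          Unique∧⊆⇒length≤ unique xs⊆x₀∷ys
    where
    xs⊆x₀∷ys : xs ⊆ x₀ ∷ ys
    xs⊆x₀∷ys {x} x∈xs with x ∈? ys
    ... | yes x∈ys = there x∈ys
    ... | no x∉ys = here (outside-equal x∈xs x₀∈xs x∉ys x₀∉ys)

after : (xs : List A) → Fin (length xs) → List A
after xs i = drop (suc (toℕ i)) xs

module _ {R : Rel A ℓ} where

  ∈-after⁻ : ∀ {xs y} → AllPairs R xs → ∀ i → y ∈ after xs i → y ∈ xs × R (lookup xs i) y
  ∈-after⁻ (x<xs ∷ _) zero y∈ = there y∈ , All.lookup x<xs y∈
  ∈-after⁻ (_ ∷ sorted) (suc i) y∈ = Product.map₁ there (∈-after⁻ sorted i y∈)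

  ∈-after⁺ : Asymmetric R → ∀ {xs y} → AllPairs R xs → ∀ i →
             y ∈ xs → R (lookup xs i) y → y ∈ after xs i
  ∈-after⁺ asym (_ ∷ _) zero (here refl) xRx = ⊥-elim (asym xRx xRx)
  ∈-after⁺ asym (_ ∷ _) zero (there y∈) _ = y∈
  ∈-after⁺ asym {_ ∷ _} (x<xs ∷ _) (suc i) (here refl) xᵢRx =
    ⊥-elim (asym xᵢRx (All.lookup x<xs (∈-lookup i)))
  ∈-after⁺ asym {_ ∷ _} (_ ∷ sorted) (suc i) (there y∈) xᵢRy = ∈-after⁺ asym sorted i y∈ xᵢRy

IsFrobenius-unique : ∀ {Λ F F'} → IsFrobenius Λ F → IsFrobenius Λ F' → F ≡ F'
IsFrobenius-unique {F = F} {F'} (F∉Λ , >F∈Λ) (F'∉Λ , >F'∈Λ) with <-cmp F F'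
... | tri< F<F' _ _ = ⊥-elim (F'∉Λ (>F∈Λ F' F<F'))
... | tri≈ _ F≡F' _ = F≡F'
... | tri> _ _ F'<F = ⊥-elim (F∉Λ (>F'∈Λ F F'<F))

remove-IsFrobenius : ∀ {Λ F g} → IsFrobenius Λ F → F < g → IsFrobenius (remove Λ g) g
remove-IsFrobenius (_ , >F∈Λ) F<g =
  (λ (_ , g≢g) → g≢g refl) , λ n g<n → >F∈Λ n (<-trans F<g g<n) , >⇒≢ g<n

remove-IsMinGen : ∀ {Λ g x} → IsMinGen Λ x → x ≢ g → IsMinGen (remove Λ g) x
remove-IsMinGen (0<x , x∈Λ , indecomposable) x≢g =
  0<x , (x∈Λ , x≢g) ,
  λ (a , b , 0<a , 0<b , (a∈Λ , _) , (b∈Λ , _) , a+b≡x) →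
    indecomposable (a , b , 0<a , 0<b , a∈Λ , b∈Λ , a+b≡x)

¬IsOrdinary⇒¬¬∃small : ∀ {Λ F} → Λ 0 → IsFrobenius Λ F → ¬ IsOrdinary Λ →
                       ¬ ¬ (∃[ e ] (0 < e × e < F × Λ e))
¬IsOrdinary⇒¬¬∃small {Λ} {F} 0∈Λ (F∉Λ , >F∈Λ) ¬ordinary ¬small =
  ¬ordinary (suc F , λ n → mk⇔ (ordinary⁺ n) (ordinary⁻ n))
  where
  ordinary⁺ : ∀ n → Λ n → n ≡ 0 ⊎ F < n
  ordinary⁺ 0 _ = inj₁ refl
  ordinary⁺ (suc n) n∈Λ with <-cmp (suc n) F
  ... | tri< n<F _ _ = ⊥-elim (¬small (suc n , s≤s z≤n , n<F , n∈Λ))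
  ... | tri≈ _ refl _ = ⊥-elim (F∉Λ n∈Λ)
  ... | tri> _ _ F<n = inj₂ F<n
  ordinary⁻ : ∀ n → n ≡ 0 ⊎ F < n → Λ n
  ordinary⁻ _ (inj₁ refl) = 0∈Λ
  ordinary⁻ n (inj₂ F<n) = >F∈Λ n F<n

ShiftedBy : Subset → ℕ → ℕ → Set
ShiftedBy Λ g x = ∃[ a ] (0 < a × Λ a × x ≡ g + a)

remove-IsMinGen-new⇒¬¬ShiftedBy : ∀ {Λ g x} → IsMinGen (remove Λ g) x → ¬ IsMinGen Λ x →
                                  ¬ ¬ ShiftedBy Λ g x
remove-IsMinGen-new⇒¬¬ShiftedBy {Λ} {g} {x} (0<x , (x∈Λ , _) , indecomposable') ¬x-gen ¬shifted =
  ¬x-gen (0<x , x∈Λ , indecomposable)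
  where
  indecomposable : ¬ (∃[ a ] ∃[ b ] (0 < a × 0 < b × Λ a × Λ b × a + b ≡ x))
  indecomposable (a , b , 0<a , 0<b , a∈Λ , b∈Λ , a+b≡x) with a ≟ g | b ≟ g
  ... | yes refl | _ = ¬shifted (b , 0<b , b∈Λ , sym a+b≡x)
  ... | no _ | yes refl = ¬shifted (a , 0<a , a∈Λ , trans (sym a+b≡x) (+-comm a g))
  ... | no a≢g | no b≢g =
    indecomposable' (a , b , 0<a , 0<b , (a∈Λ , a≢g) , (b∈Λ , b≢g) , a+b≡x)

remove-IsMinGen-shift-minimal : ∀ {Λ F g a c} → IsFrobenius Λ F → F < g →
  IsMinGen (remove Λ g) (g + a) → 0 < c → Λ c → c ≢ g → a ≤ c
remove-IsMinGen-shift-minimal {g = g} {a} {c} (_ , >F∈Λ) F<g (_ , _ , indecomposable) 0<c c∈Λ c≢g =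
  ≮⇒≥ λ c<a →
    let g<u = m<m+n g (m<n⇒0<n∸m c<a) in
    indecomposable (g + (a ∸ c) , c , ≤-<-trans z≤n g<u , 0<c ,
                    (>F∈Λ _ (<-trans F<g g<u) , >⇒≢ g<u) , (c∈Λ , c≢g) ,
                    (begin
                      g + (a ∸ c) + c ≡⟨ +-assoc g (a ∸ c) c ⟩
                      g + (a ∸ c + c) ≡⟨ cong (g +_) (m∸n+n≡m (<⇒≤ c<a)) ⟩
                      g + a           ∎))
  where open ≡-Reasoning

remove-IsMinGen-ShiftedBy-unique : ∀ {Λ F g x y} → IsFrobenius Λ F → F < g →
  ∃[ e ] (0 < e × e < F × Λ e) →
  IsMinGen (remove Λ g) x → IsMinGen (remove Λ g) y → ShiftedBy Λ g x → ShiftedBy Λ g y → x ≡ y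
remove-IsMinGen-ShiftedBy-unique {Λ} {g = g} frob F<g (e , 0<e , e<F , e∈Λ)
  x-gen y-gen (a , 0<a , a∈Λ , refl) (b , 0<b , b∈Λ , refl) =
  cong (g +_) (≤-antisym (minimal x-gen 0<b b∈Λ (shift≢g y-gen))
                         (minimal y-gen 0<a a∈Λ (shift≢g x-gen)))
  where
  minimal : ∀ {a c} → IsMinGen (remove Λ g) (g + a) → 0 < c → Λ c → c ≢ g → a ≤ c
  minimal = remove-IsMinGen-shift-minimal frob F<g

  e<g : e < g
  e<g = <-trans e<F F<g

  shift≢g : ∀ {c} → IsMinGen (remove Λ g) (g + c) → c ≢ g
  shift≢g c-gen = <⇒≢ (≤-<-trans (minimal c-gen 0<e e∈Λ (<⇒≢ e<g)) e<g)

lemma3 : (Λ : Subset) → IsNumericalSemigroup Λ → ¬ IsOrdinary Λ →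
         (F : ℕ) → IsFrobenius Λ F →
         (gs : List ℕ) → Linked _<_ gs →
         (∀ x → x ∈ gs ⇔ (IsMinGen Λ x × F < x)) →
         (i : Fin (length gs)) →
         (F' : ℕ) → IsFrobenius (remove Λ (lookup gs i)) F' →
         (hs : List ℕ) → Unique hs →
         (∀ x → x ∈ hs ⇔ (IsMinGen (remove Λ (lookup gs i)) x × F' < x)) →
         (length gs ∸ suc (toℕ i) ≤ length hs)
           × (length hs ≤ length gs ∸ suc (toℕ i) + 1)
lemma3 Λ ns ¬ordinary F frob gs sorted gs-spec i F' frob' hs hs-unique hs-spec =
  subst (_≤ length hs) (length-drop (suc (toℕ i)) gs)
    (Unique∧⊆⇒length≤ (Unique.drop⁺ (suc (toℕ i)) (AllPairs.map <⇒≢ sorted′)) later⊆hs) ,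
  subst (length hs ≤_) (trans (+-comm 1 _) (cong (_+ 1) (length-drop (suc (toℕ i)) gs)))
    (Unique∧⊆-but-one⇒length≤ _≟_ hs-unique new-generator-unique)
  where
  g = lookup gs i
  sorted′ = Linked⇒AllPairs <-trans sorted
  F<g : F < g
  F<g = proj₂ (to (gs-spec g) (∈-lookup i))
  F'≡g : F' ≡ g
  F'≡g = IsFrobenius-unique frob' (remove-IsFrobenius frob F<g)

  later⊆hs : after gs i ⊆ hs
  later⊆hs {y} y∈later with y∈gs , g<y ← ∈-after⁻ sorted′ i y∈later =
    from (hs-spec y) (remove-IsMinGen (proj₁ (to (gs-spec y) y∈gs)) (>⇒≢ g<y) ,
                      subst (_< y) (sym F'≡g) g<y)

  old-generator-later : ∀ {x} → x ∈ hs → IsMinGen Λ x → x ∈ after gs i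
  old-generator-later {x} x∈hs x-gen =
    ∈-after⁺ <-asym sorted′ i (from (gs-spec x) (x-gen , <-trans F<g g<x)) g<x
    where g<x = subst (_< x) F'≡g (proj₂ (to (hs-spec x) x∈hs))

  new-generator-unique : ∀ {x y} → x ∈ hs → y ∈ hs → x ∉ after gs i → y ∉ after gs i → x ≡ y
  new-generator-unique {x} {y} x∈hs y∈hs x-new y-new = decidable-stable (x ≟ y) λ x≢y →
    ¬IsOrdinary⇒¬¬∃small (IsNumericalSemigroup.zero∈ ns) frob ¬ordinary λ small →
    remove-IsMinGen-new⇒¬¬ShiftedBy x-gen (x-new ∘ old-generator-later x∈hs) λ x-shifted →
    remove-IsMinGen-new⇒¬¬ShiftedBy y-gen (y-new ∘ old-generator-later y∈hs) λ y-shifted →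
    x≢y (remove-IsMinGen-ShiftedBy-unique frob F<g small x-gen y-gen x-shifted y-shifted)
    where
    x-gen = proj₁ (to (hs-spec x) x∈hs)
    y-gen = proj₁ (to (hs-spec y) y∈hs)
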